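{- Let $c:V(H)\to\Omega$ be an equitable vertex-colouring of a graph $H$, and let $L\in\{0,1\}^{\Omega\times\Omega}$. Let $H_1=D_L(H,c)$ and $H_2=D(H,c)$, and for a vertex $v$ let $X_1(v),X_2(v)$ be the vertex sets of the connected components containing $v$ in $H_1$ and $H_2$ respectively. Then $|X_2(v)|\le 2|X_1(v)|$. (Consequently the same inequality holds when $H_1=D(H,c_0)$ for some coarsening $c_0$ of $c$.)
   Context: A colouring $c$ of $H$ is equitable if for any two distinct colour classes $A,B$, $H[A]$ is regular and the bipartite graph $H[A,B]$ between $A$ and $B$ is biregular. For $L\in\{0,1\}^{\Omega\times\Omega}$ (presumably symmetric), $M_L(H,c)$ is the graph on $V(H)$ containing all possible edges between vertices of colours $\omega,\omega'$ when $L_{\omega,\omega'}=1$ and none when $L_{\omega,\omega'}=0$; the generalised disparity graph is $D_L(H,c)=M_L(H,c)\triangle H$. The disparity graph $D(H,c)$ is $D_L(H,c)$ with $L_{\omega,\omega'}=1$ exactly when at least half of the possible edges between colour $\omega$ and colour $\omega'$ are present in $H$. A coarsening $c_0$ of $c$ is a colouring each of whose colour classes is a union of colour classes of $c$. -}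

module Defs where

open import Data.Nat using (ℕ; zero; suc; _+_; _*_; _≤_; _≤?_)
open import Data.Fin using (Fin; zero; suc)
open import Data.Fin.Properties using (_≟_)
open import Data.Bool using (Bool; true; false; _∧_; _xor_; not; if_then_else_)
open import Data.Product using (Σ; _×_)
open import Relation.Nullary.Decidable using (⌊_⌋)
open import Relation.Binary.PropositionalEquality using (_≡_)

Adj : ℕ → Set
Adj n = Fin n → Fin n → Bool

record IsGraph {n : ℕ} (H : Adj n) : Set where
  field
    sym   : ∀ v w → H v w ≡ H w v
    irrefl : ∀ v → H v v ≡ false

count : ∀ {n} → (Fin n → Bool) → ℕ
count {zero}  P = 0
count {suc n} P = (if P zero then 1 else 0) + count (λ i → P (suc i))

_has_ : ∀ {n k} → (Fin n → Fin k) → Fin k → Fin n → Bool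
(c has ω) v = ⌊ c v ≟ ω ⌋

degTo : ∀ {n k} → Adj n → (Fin n → Fin k) → Fin n → Fin k → ℕ
degTo H c v ω = count (λ w → H v w ∧ (c has ω) w)

-- Equitable colouring: for all colours ω, ω' there is d such that every
-- vertex of colour ω has exactly d neighbours of colour ω'.
-- (ω = ω' gives regularity of H[A]; ω ≠ ω' gives biregularity of H[A,B].)
Equitable : ∀ {n k} → Adj n → (Fin n → Fin k) → Set
Equitable H c = ∀ ω ω' → Σ ℕ λ d → ∀ v → c v ≡ ω → degTo H c v ω' ≡ d

M : ∀ {n k} → (Fin k → Fin k → Bool) → (Fin n → Fin k) → Adj n
M L c v w = not ⌊ v ≟ w ⌋ ∧ L (c v) (c w)

DL : ∀ {n k} → Adj n → (Fin n → Fin k) → (Fin k → Fin k → Bool) → Adj n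
DL H c L v w = M L c v w xor H v w

sumF : ∀ {n} → (Fin n → ℕ) → ℕ
sumF {zero}  f = 0
sumF {suc n} f = f zero + sumF (λ i → f (suc i))

pairsWith : ∀ {n k} → Adj n → (Fin n → Fin k) → Fin k → Fin k → ℕ
pairsWith P c ω ω' =
  sumF (λ v → count (λ w → (c has ω) v ∧ (c has ω') w ∧ not ⌊ v ≟ w ⌋ ∧ P v w))

possiblePairs : ∀ {n k} → (Fin n → Fin k) → Fin k → Fin k → ℕ
possiblePairs = pairsWith (λ _ _ → true)

presentPairs : ∀ {n k} → Adj n → (Fin n → Fin k) → Fin k → Fin k → ℕ
presentPairs H = pairsWith H

-- Counting ordered pairs
-- both quantities are doubled when ω = ω', so the ratio is unaffected.
halfL : ∀ {n k} → Adj n → (Fin n → Fin k) → Fin k → Fin k → Bool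
halfL H c ω ω' = ⌊ possiblePairs c ω ω' ≤? 2 * presentPairs H c ω ω' ⌋

D : ∀ {n k} → Adj n → (Fin n → Fin k) → Adj n
D H c = DL H c (halfL H c)

data Reach {n : ℕ} (G : Adj n) (u : Fin n) : Fin n → Set where
  here : Reach G u u
  step : ∀ {v w} → Reach G u v → G v w ≡ true → Reach G u w

IsComponent : ∀ {n} → Adj n → Fin n → (Fin n → Bool) → Set
IsComponent G v X = ∀ w → (X w ≡ true → Reach G v w) × (Reach G v w → X w ≡ true)

Coarsening : ∀ {n k k₀} → (Fin n → Fin k₀) → (Fin n → Fin k) → Set
Coarsening c₀ c = ∀ v w → c v ≡ c w → c₀ v ≡ c₀ w

{-# OPTIONS --safe #-}
module Submission where

-- Write G = D(H,c) and G₁ = D_{L₀}(H,c₀), where c₀ is a coarsening of c (c₀ = c covers the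
-- first part, L₀ = the half-density rule of c₀ the second); nothing else is used about G₁.
-- Both G and its transpose are equitable for c, and every vertex is G-adjacent to at most half
-- of each colour class. Let X₁⁺ be X₁ together with every class at least half of which lies in
-- X₁; then |X₁⁺| ≤ 2|X₁|, and X₁⁺ is closed under G-edges, so it contains X₂. For a G-edge uw
-- with u ∈ X₁⁺ pick u′ ∈ X₁ of the colour of u. Between the c-classes of u′ and w, G₁ either
-- equals G, or is its complement off the diagonal. In the first case X₁ is closed under the
-- G-edges between the two classes, and double counting them in the biregular bipartite graph
-- carries the density ≥ 1/2 of X₁ from one class to the other. In the second case every
-- non-neighbour of u′ in the class of w lies in X₁, and u′ has at most half of that class as
-- G-neighbours.

open import Defs
open import Algebra.Bundles using (CommutativeMonoid)
open import Data.Bool using (Bool; true; false; _∧_; _∨_; _xor_; not; if_then_else_)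
open import Data.Bool.Properties
  using (∧-zeroʳ; ∧-identityʳ; ∧-comm; ∧-commutativeMonoid; not-distribˡ-xor; ∨-zeroʳ; ∨-identityʳ)
open import Data.Fin using (Fin; zero; suc)
open import Data.Fin.Properties using (_≟_; suc-injective)
open import Data.Nat using (ℕ; zero; suc; _+_; _*_; _∸_; _≤_; _≤?_; z≤n; s≤s; NonZero; >-nonZero)
open import Data.Nat.Properties
  using ( ≤-refl; ≤-trans; ≤-reflexive; m≤m+n; <⇒≤; ≰⇒>; module ≤-Reasoning
        ; +-identityʳ; +-mono-≤; +-monoˡ-≤; +-monoʳ-≤; +-cancelˡ-≤; +-cancelʳ-≤; m+n∸n≡m
        ; *-assoc; *-distribʳ-+; *-monoˡ-≤; *-monoʳ-≤; *-cancelˡ-≤; *-cancelʳ-≤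
        ; +-*-semiring; +-commutativeSemigroup; *-commutativeSemigroup )
open import Data.Product using (∃; _×_; _,_; proj₁; proj₂)
open import Data.Sum using (_⊎_; inj₁; inj₂)
open import Function using (_∘_; flip)
open import Function.Bundles using (mk⇔)
open import Relation.Binary.PropositionalEquality
open import Relation.Nullary using (Dec; yes; no; ¬_)
open import Relation.Nullary.Decidable using (⌊_⌋; ⌊⌋-map′; isYes≗does; does-⇔; dec-true; dec-false)
open import Algebra.Properties.CommutativeSemigroup +-commutativeSemigroup using (interchange)
open import Algebra.Properties.CommutativeSemigroup *-commutativeSemigroup using (x∙yz≈y∙xz)
open import Algebra.Properties.CommutativeSemigroup
  (CommutativeMonoid.commutativeSemigroup ∧-commutativeMonoid)
  using () renaming (x∙yz≈z∙yx to x∧yz≡z∧yx)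
open import Algebra.Properties.Semiring.Sum +-*-semiring
  using (sum; ∑-comm; sum-cong-≗; *-distribˡ-sum)

𝟙 : Bool → ℕ
𝟙 b = if b then 1 else 0

infixr 6 _∩_
_∩_ : ∀ {n} → (Fin n → Bool) → (Fin n → Bool) → Fin n → Bool
(P ∩ Q) i = P i ∧ Q i

∧-elim : ∀ {a b} → a ∧ b ≡ true → a ≡ true × b ≡ true
∧-elim {true} b≡true = refl , b≡true

∧-cong-when : ∀ {a b} s → (s ≡ true → a ≡ b) → a ∧ s ≡ b ∧ s
∧-cong-when {a} {b} false _   = trans (∧-zeroʳ a) (sym (∧-zeroʳ b))
∧-cong-when         true  a≡b = cong (_∧ true) (a≡b refl)

≡-or-≡not : ∀ a b → a ≡ b ⊎ a ≡ not b
≡-or-≡not false false = inj₁ refl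
≡-or-≡not true  true  = inj₁ refl
≡-or-≡not false true  = inj₂ refl
≡-or-≡not true  false = inj₂ refl

⌊⌋-⇔ : ∀ {A B : Set} (a? : Dec A) (b? : Dec B) → (A → B) → (B → A) → ⌊ a? ⌋ ≡ ⌊ b? ⌋
⌊⌋-⇔ a? b? a⇒b b⇒a =
  trans (isYes≗does a?) (trans (does-⇔ (mk⇔ a⇒b b⇒a) a? b?) (sym (isYes≗does b?)))

⌊≟⌋-sym : ∀ {n} (u w : Fin n) → ⌊ u ≟ w ⌋ ≡ ⌊ w ≟ u ⌋
⌊≟⌋-sym u w = ⌊⌋-⇔ (u ≟ w) (w ≟ u) sym sym

⌊⌋-true : ∀ {A : Set} (a? : Dec A) → A → ⌊ a? ⌋ ≡ true
⌊⌋-true a? a = trans (isYes≗does a?) (dec-true a? a)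

⌊⌋-false : ∀ {A : Set} (a? : Dec A) → ¬ A → ⌊ a? ⌋ ≡ false
⌊⌋-false a? ¬a = trans (isYes≗does a?) (dec-false a? ¬a)

has⇒≡ : ∀ {n k} (c : Fin n → Fin k) {ω} w → (c has ω) w ≡ true → c w ≡ ω
has⇒≡ c {ω} w _ with c w ≟ ω
has⇒≡ c w _  | yes cw≡ω = cw≡ω
has⇒≡ c w () | no _

≡⇒has : ∀ {n k} (c : Fin n → Fin k) {ω} w → c w ≡ ω → (c has ω) w ≡ true
≡⇒has c {ω} w = ⌊⌋-true (c w ≟ ω)

m+n≡o⇒m≡o∸n : ∀ {m n o} → m + n ≡ o → m ≡ o ∸ n
m+n≡o⇒m≡o∸n {m} {n} m+n≡o = trans (sym (m+n∸n≡m m n)) (cong (_∸ n) m+n≡o)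

count-cong : ∀ {n} {P Q : Fin n → Bool} → (∀ i → P i ≡ Q i) → count P ≡ count Q
count-cong {zero}  _   = refl
count-cong {suc n} P≗Q = cong₂ _+_ (cong 𝟙 (P≗Q zero)) (count-cong (P≗Q ∘ suc))

count-mono : ∀ {n} {P Q : Fin n → Bool} → (∀ i → P i ≡ true → Q i ≡ true) → count P ≤ count Q
count-mono {zero}  _   = z≤n
count-mono {suc n} P⊆Q = +-mono-≤ (𝟙-mono (P⊆Q zero)) (count-mono (P⊆Q ∘ suc))
  where
  𝟙-mono : ∀ {a b} → (a ≡ true → b ≡ true) → 𝟙 a ≤ 𝟙 b
  𝟙-mono {false} _   = z≤n
  𝟙-mono {true}  a⇒b rewrite a⇒b refl = ≤-refl

count-false : ∀ {n} → count {n} (λ _ → false) ≡ 0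
count-false {zero}  = refl
count-false {suc n} = count-false {n}

count-+ : ∀ {n} {P Q R : Fin n → Bool} → (∀ i → 𝟙 (P i) + 𝟙 (Q i) ≡ 𝟙 (R i)) →
  count P + count Q ≡ count R
count-+ {zero}  _ = refl
count-+ {suc n} {P} {Q} pointwise =
  trans (interchange (𝟙 (P zero)) (count (P ∘ suc)) (𝟙 (Q zero)) (count (Q ∘ suc)))
        (cong₂ _+_ (pointwise zero) (count-+ (pointwise ∘ suc)))

count-singleton : ∀ {n} (u : Fin n) (P : Fin n → Bool) → count (λ w → ⌊ u ≟ w ⌋ ∧ P w) ≡ 𝟙 (P u)
count-singleton {suc n} zero    P = trans (cong (𝟙 (P zero) +_) (count-false {n})) (+-identityʳ _)
count-singleton {suc n} (suc u) P =
  trans (count-cong (λ i → cong (_∧ P (suc i)) (⌊⌋-map′ (cong suc) suc-injective (u ≟ i))))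
        (count-singleton u (λ i → P (suc i)))

count-positive : ∀ {n} {P : Fin n → Bool} u → P u ≡ true → 1 ≤ count P
count-positive {P = P} u Pu = begin
  1                                ≡⟨ cong 𝟙 Pu ⟨
  𝟙 (P u)                          ≡⟨ count-singleton u P ⟨
  count (λ w → ⌊ u ≟ w ⌋ ∧ P w)    ≤⟨ count-mono (λ w → proj₂ ∘ ∧-elim {⌊ u ≟ w ⌋}) ⟩
  count P                          ∎
  where open ≤-Reasoning

count-witness : ∀ {n} (P : Fin n → Bool) → 1 ≤ count P → ∃ λ u → P u ≡ true
count-witness {suc n} P 1≤count with P zero in P0
... | true  = zero , P0
... | false = let (u , Pu) = count-witness (P ∘ suc) 1≤count in suc u , Pu

count≡sum : ∀ {n} (P : Fin n → Bool) → count P ≡ sum (𝟙 ∘ P)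
count≡sum {zero}  P = refl
count≡sum {suc n} P = cong (𝟙 (P zero) +_) (count≡sum (P ∘ suc))

sumF≡sum : ∀ {n} (f : Fin n → ℕ) → sumF f ≡ sum f
sumF≡sum {zero}  f = refl
sumF≡sum {suc n} f = cong (f zero +_) (sumF≡sum (f ∘ suc))

sum-mono : ∀ {n} {f g : Fin n → ℕ} → (∀ i → f i ≤ g i) → sum f ≤ sum g
sum-mono {zero}  _   = z≤n
sum-mono {suc n} f≤g = +-mono-≤ (f≤g zero) (sum-mono (f≤g ∘ suc))

sum-count-rows : ∀ {m n} (P : Fin m → Bool) (F : Fin m → Fin n → Bool) e →
  (∀ b → P b ≡ true → count (F b) ≡ e) → sum (λ b → count (λ y → P b ∧ F b y)) ≡ count P * e
sum-count-rows {zero}      P F e _    = refl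
sum-count-rows {suc m} {n} P F e rows =
  trans (cong₂ _+_ (first-row (P zero) (rows zero))
                   (sum-count-rows (λ b → P (suc b)) (λ b → F (suc b)) e (λ b → rows (suc b))))
        (sym (*-distribʳ-+ e (𝟙 (P zero)) (count (λ b → P (suc b)))))
  where
  first-row : ∀ p → (p ≡ true → count (F zero) ≡ e) → count (λ y → p ∧ F zero y) ≡ 𝟙 p * e
  first-row true  row = trans (row refl) (sym (+-identityʳ e))
  first-row false _   = count-false {n}

count-by-class : ∀ {n k} (c : Fin n → Fin k) P → count P ≡ sum (λ ω → count (P ∩ (c has ω)))
count-by-class c P = begin
  count P
    ≡⟨ count≡sum P ⟩
  sum (λ w → 𝟙 (P w))
    ≡⟨ sum-cong-≗ (λ w → count-singleton (c w) (λ _ → P w)) ⟨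
  sum (λ w → count (λ ω → ⌊ c w ≟ ω ⌋ ∧ P w))
    ≡⟨ sum-cong-≗ (λ w → count≡sum (λ ω → ⌊ c w ≟ ω ⌋ ∧ P w)) ⟩
  sum (λ w → sum (λ ω → 𝟙 (⌊ c w ≟ ω ⌋ ∧ P w)))
    ≡⟨ ∑-comm (λ w ω → 𝟙 (⌊ c w ≟ ω ⌋ ∧ P w)) ⟩
  sum (λ ω → sum (λ w → 𝟙 (⌊ c w ≟ ω ⌋ ∧ P w)))
    ≡⟨ sum-cong-≗ (λ ω → sum-cong-≗ λ w → cong 𝟙 (∧-comm ⌊ c w ≟ ω ⌋ (P w))) ⟩
  sum (λ ω → sum (λ w → 𝟙 (P w ∧ ⌊ c w ≟ ω ⌋)))
    ≡⟨ sum-cong-≗ (λ ω → count≡sum (P ∩ (c has ω))) ⟨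
  sum (λ ω → count (P ∩ (c has ω)))
    ∎
  where open ≡-Reasoning

count-≤-by-class : ∀ {n k} (c : Fin n → Fin k) {X Y : Fin n → Bool} m →
  (∀ ω → count (Y ∩ (c has ω)) ≤ m * count (X ∩ (c has ω))) → count Y ≤ m * count X
count-≤-by-class c {X} {Y} m classwise = begin
  count Y                                   ≡⟨ count-by-class c Y ⟩
  sum (λ ω → count (Y ∩ (c has ω)))         ≤⟨ sum-mono classwise ⟩
  sum (λ ω → m * count (X ∩ (c has ω)))     ≡⟨ *-distribˡ-sum m (λ ω → count (X ∩ (c has ω))) ⟨
  m * sum (λ ω → count (X ∩ (c has ω)))     ≡⟨ cong (m *_) (count-by-class c X) ⟨
  m * count X                               ∎
  where open ≤-Reasoning

module _ {n} {G : Adj n} {v : Fin n} {X : Fin n → Bool} (component : IsComponent G v X) where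

  component-root : X v ≡ true
  component-root = proj₂ (component v) here

  component-closed : ∀ {u w} → X u ≡ true → G u w ≡ true → X w ≡ true
  component-closed Xu Guw = proj₂ (component _) (step (proj₁ (component _) Xu) Guw)

  component-minimal : (Y : Fin n → Bool) → Y v ≡ true →
    (∀ {u w} → Y u ≡ true → G u w ≡ true → Y w ≡ true) → ∀ w → X w ≡ true → Y w ≡ true
  component-minimal Y Yv Y-closed w Xw = reachable⇒Y (proj₁ (component w) Xw)
    where
    reachable⇒Y : ∀ {w} → Reach G v w → Y w ≡ true
    reachable⇒Y here          = Yv
    reachable⇒Y (step r Guw) = Y-closed (reachable⇒Y r) Guw

equitable⇒degTo-const : ∀ {n k} {G : Adj n} {c : Fin n → Fin k} → Equitable G c →
  ∀ {u v} ω → c v ≡ c u → degTo G c v ω ≡ degTo G c u ω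
equitable⇒degTo-const {c = c} equitable {u} ω cv≡cu =
  let (d , deg≡d) = equitable (c u) ω in trans (deg≡d _ cv≡cu) (sym (deg≡d u refl))

edgeCount : ∀ {n} → Adj n → (Fin n → Bool) → (Fin n → Bool) → ℕ
edgeCount G P Q = sum (λ b → count (λ y → P b ∧ (G b y ∧ Q y)))

edgeCount-transpose : ∀ {n} (G : Adj n) P Q → edgeCount G P Q ≡ edgeCount (flip G) Q P
edgeCount-transpose G P Q = begin
  sum (λ b → count (λ y → P b ∧ (G b y ∧ Q y)))
    ≡⟨ sum-cong-≗ (λ b → count≡sum (λ y → P b ∧ (G b y ∧ Q y))) ⟩
  sum (λ b → sum (λ y → 𝟙 (P b ∧ (G b y ∧ Q y))))
    ≡⟨ ∑-comm (λ b y → 𝟙 (P b ∧ (G b y ∧ Q y))) ⟩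
  sum (λ y → sum (λ b → 𝟙 (P b ∧ (G b y ∧ Q y))))
    ≡⟨ sum-cong-≗ (λ y → sum-cong-≗ λ b → cong 𝟙 (x∧yz≡z∧yx (P b) (G b y) (Q y))) ⟩
  sum (λ y → sum (λ b → 𝟙 (Q y ∧ (G b y ∧ P b))))
    ≡⟨ sum-cong-≗ (λ y → count≡sum (λ b → Q y ∧ (G b y ∧ P b))) ⟨
  sum (λ y → count (λ b → Q y ∧ (G b y ∧ P b)))
    ∎
  where open ≡-Reasoning

edgeCount-mono : ∀ {n} (G : Adj n) {P Q P′ Q′} →
  (∀ b y → P b ∧ (G b y ∧ Q y) ≡ true → P′ b ∧ (G b y ∧ Q′ y) ≡ true) →
  edgeCount G P Q ≤ edgeCount G P′ Q′
edgeCount-mono G edge⇒edge = sum-mono λ b → count-mono (edge⇒edge b)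

module _ {n k} {G : Adj n} {c : Fin n → Fin k}
         (out-equitable : Equitable G c) (in-equitable : Equitable (flip G) c) where

  density-transfer : ∀ (X : Fin n → Bool) m {u w} → G u w ≡ true →
    (∀ b y → c b ≡ c u → c y ≡ c w → X b ≡ true → G b y ≡ true → X y ≡ true) →
    count (c has c u) ≤ m * count (X ∩ (c has c u)) →
    count (c has c w) ≤ m * count (X ∩ (c has c w))
  density-transfer X m {u} {w} Guw X-closed B-dense = *-cancelʳ-≤ _ _ e′ (begin
    ∣ C ∣ * e′                        ≡⟨ C-rows C (λ _ y∈C → y∈C) ⟨
    edgeCount (flip G) C B            ≡⟨ edgeCount-transpose G B C ⟨
    edgeCount G B C                   ≡⟨ B-rows B (λ _ b∈B → b∈B) ⟩
    ∣ B ∣ * e                         ≤⟨ *-monoˡ-≤ e B-dense ⟩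
    m * ∣ X ∩ B ∣ * e                 ≡⟨ *-assoc m _ e ⟩
    m * (∣ X ∩ B ∣ * e)               ≡⟨ cong (m *_) (B-rows (X ∩ B) (λ b → proj₂ ∘ ∧-elim {X b})) ⟨
    m * edgeCount G (X ∩ B) C         ≤⟨ *-monoʳ-≤ m X-edges ⟩
    m * edgeCount G B (X ∩ C)         ≡⟨ cong (m *_) (edgeCount-transpose G B (X ∩ C)) ⟩
    m * edgeCount (flip G) (X ∩ C) B  ≡⟨ cong (m *_) (C-rows (X ∩ C) (λ y → proj₂ ∘ ∧-elim {X y})) ⟩
    m * (∣ X ∩ C ∣ * e′)              ≡⟨ *-assoc m _ e′ ⟨
    m * ∣ X ∩ C ∣ * e′                ∎)
    where
    open ≤-Reasoning
    ∣_∣ = count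
    B = c has c u
    C = c has c w
    e  = proj₁ (out-equitable (c u) (c w))
    e′ = proj₁ (in-equitable (c w) (c u))
    B-rows : ∀ P → (∀ b → P b ≡ true → B b ≡ true) → edgeCount G P C ≡ ∣ P ∣ * e
    B-rows P P⊆B = sum-count-rows P (λ b y → G b y ∧ C y) e λ b Pb →
      proj₂ (out-equitable (c u) (c w)) b (has⇒≡ c b (P⊆B b Pb))
    C-rows : ∀ P → (∀ y → P y ≡ true → C y ≡ true) → edgeCount (flip G) P B ≡ ∣ P ∣ * e′
    C-rows P P⊆C = sum-count-rows P (λ y b → G b y ∧ B b) e′ λ y Py →
      proj₂ (in-equitable (c w) (c u)) y (has⇒≡ c y (P⊆C y Py))
    X-edge : ∀ b y → (X ∩ B) b ∧ (G b y ∧ C y) ≡ true → B b ∧ (G b y ∧ (X ∩ C) y) ≡ true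
    X-edge b y edge =
      let (b∈X∩B , Gby∧y∈C) = ∧-elim {(X ∩ B) b} edge
          (b∈X , b∈B) = ∧-elim {X b} b∈X∩B
          (Gby , y∈C) = ∧-elim {G b y} Gby∧y∈C
          y∈X = X-closed b y (has⇒≡ c b b∈B) (has⇒≡ c y y∈C) b∈X Gby
      in cong₂ _∧_ b∈B (cong₂ _∧_ Gby (cong₂ _∧_ y∈X y∈C))
    X-edges : edgeCount G (X ∩ B) C ≤ edgeCount G B (X ∩ C)
    X-edges = edgeCount-mono G {X ∩ B} {C} {B} {X ∩ C} X-edge
    instance
      e′-nonZero : NonZero e′
      e′-nonZero = >-nonZero (subst (1 ≤_) (proj₂ (in-equitable (c w) (c u)) w refl)
                                   (count-positive u (cong₂ _∧_ Guw (≡⇒has c u refl))))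

complete : ∀ {n} → Adj n
complete u w = not ⌊ u ≟ w ⌋

distinct⇒complete : ∀ {n} {u w : Fin n} → u ≢ w → complete u w ≡ true
distinct⇒complete {u = u} {w} u≢w = cong not (⌊⌋-false (u ≟ w) u≢w)

module _ {n k} (c : Fin n → Fin k) where

  degTo-cong : ∀ {G G′ : Adj n} → (∀ u w → G u w ≡ G′ u w) →
    ∀ u ω → degTo G c u ω ≡ degTo G′ c u ω
  degTo-cong G≗G′ u ω = count-cong (λ w → cong (_∧ (c has ω) w) (G≗G′ u w))

  degTo-complete : ∀ u ω → degTo complete c u ω + 𝟙 ((c has ω) u) ≡ count (c has ω)
  degTo-complete u ω =
    trans (cong (degTo complete c u ω +_) (sym (count-singleton u (c has ω))))
          (count-+ (λ w → split ⌊ u ≟ w ⌋ ((c has ω) w)))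
    where
    split : ∀ a s → 𝟙 (not a ∧ s) + 𝟙 (a ∧ s) ≡ 𝟙 s
    split false s = +-identityʳ (𝟙 s)
    split true  s = refl

  complete-equitable : Equitable complete c
  complete-equitable ω ω′ = count (c has ω′) ∸ 𝟙 ⌊ ω ≟ ω′ ⌋ , λ v cv≡ω →
    m+n≡o⇒m≡o∸n (trans (cong (λ x → degTo complete c v ω′ + 𝟙 ⌊ x ≟ ω′ ⌋) (sym cv≡ω))
                       (degTo-complete v ω′))

module _ {n k} {H : Adj n} (isGraph : IsGraph H) (c : Fin n → Fin k) where

  adjacent⇒complete : ∀ u w → H u w ≡ true → complete u w ≡ true
  adjacent⇒complete u w Huw with u ≟ w
  ... | no _     = refl
  ... | yes refl with () ← trans (sym Huw) (IsGraph.irrefl isGraph u)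

  degTo-DL-within : ∀ L u ω ℓ → L (c u) ω ≡ ℓ →
    degTo (DL H c L) c u ω ≡ count (λ w → ((complete u w ∧ ℓ) xor H u w) ∧ (c has ω) w)
  degTo-DL-within L u ω ℓ L≡ℓ = count-cong λ w → ∧-cong-when ((c has ω) w) λ w∈ω →
    cong (λ l → (complete u w ∧ l) xor H u w) (trans (cong (L (c u)) (has⇒≡ c w w∈ω)) L≡ℓ)

  degTo-DL-false : ∀ L u ω → L (c u) ω ≡ false → degTo (DL H c L) c u ω ≡ degTo H c u ω
  degTo-DL-false L u ω L≡false = trans (degTo-DL-within L u ω false L≡false)
    (count-cong λ w → cong (λ x → (x xor H u w) ∧ (c has ω) w) (∧-zeroʳ (complete u w)))

  degTo-DL-true : ∀ L u ω → L (c u) ω ≡ true →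
    degTo (DL H c L) c u ω + degTo H c u ω ≡ degTo complete c u ω
  degTo-DL-true L u ω L≡true =
    trans (cong (_+ degTo H c u ω) (degTo-DL-within L u ω true L≡true))
          (count-+ λ w → split (complete u w) (H u w) ((c has ω) w) (adjacent⇒complete u w))
    where
    split : ∀ a h s → (h ≡ true → a ≡ true) → 𝟙 (((a ∧ true) xor h) ∧ s) + 𝟙 (h ∧ s) ≡ 𝟙 (a ∧ s)
    split true  true  s _   = refl
    split true  false s _   = +-identityʳ (𝟙 s)
    split false false s _   = refl
    split false true  s h⇒a with () ← h⇒a refl

  DL-equitable : Equitable H c → ∀ L → Equitable (DL H c L) c
  DL-equitable equitable L ω ω′ with equitable ω ω′ | L ω ω′ in Lωω′
  ... | d , degH≡d | false = d , λ v cv≡ω →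
    trans (degTo-DL-false L v ω′ (trans (cong (λ x → L x ω′) cv≡ω) Lωω′)) (degH≡d v cv≡ω)
  ... | d , degH≡d | true =
    let (d₀ , degK≡d₀) = complete-equitable c ω ω′ in
    d₀ ∸ d , λ v cv≡ω → m+n≡o⇒m≡o∸n
      (trans (cong (degTo (DL H c L) c v ω′ +_) (sym (degH≡d v cv≡ω)))
             (trans (degTo-DL-true L v ω′ (trans (cong (λ x → L x ω′) cv≡ω) Lωω′))
                    (degK≡d₀ v cv≡ω)))

  DL-transpose : ∀ L u w → DL H c L w u ≡ DL H c (flip L) u w
  DL-transpose L u w =
    cong₂ (λ a h → (not a ∧ L (c w) (c u)) xor h) (⌊≟⌋-sym w u) (IsGraph.sym isGraph w u)

  DL-transpose-equitable : Equitable H c → ∀ L → Equitable (flip (DL H c L)) c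
  DL-transpose-equitable equitable L ω ω′ =
    let (d , deg≡d) = DL-equitable equitable (flip L) ω ω′ in
    d , λ v cv≡ω → trans (degTo-cong c (DL-transpose L) v ω′) (deg≡d v cv≡ω)

  pairsWith-regular : ∀ (P : Adj n) ω ω′ d →
    (∀ v → c v ≡ ω → count (λ w → (c has ω′) w ∧ (not ⌊ v ≟ w ⌋ ∧ P v w)) ≡ d) →
    pairsWith P c ω ω′ ≡ count (c has ω) * d
  pairsWith-regular P ω ω′ d deg≡d =
    trans (sumF≡sum {n} _)
          (sum-count-rows (c has ω) (λ v w → (c has ω′) w ∧ (not ⌊ v ≟ w ⌋ ∧ P v w)) d
             λ v v∈ω → deg≡d v (has⇒≡ c v v∈ω))

  module _ (equitable : Equitable H c) (u : Fin n) (ω : Fin k) where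

    possiblePairs≡ : possiblePairs c (c u) ω ≡ count (c has c u) * degTo complete c u ω
    possiblePairs≡ = pairsWith-regular _ (c u) ω _ λ v cv≡cu →
      trans (count-cong λ w →
               trans (∧-comm ((c has ω) w) _) (cong (_∧ (c has ω) w) (∧-identityʳ (complete v w))))
            (equitable⇒degTo-const (complete-equitable c) ω cv≡cu)

    presentPairs≡ : presentPairs H c (c u) ω ≡ count (c has c u) * degTo H c u ω
    presentPairs≡ = pairsWith-regular H (c u) ω _ λ v cv≡cu →
      trans (count-cong λ w → trans (∧-comm ((c has ω) w) _) (cong (_∧ (c has ω) w) (edge v w)))
            (equitable⇒degTo-const equitable ω cv≡cu)
      where
      edge : ∀ v w → complete v w ∧ H v w ≡ H v w
      edge v w with H v w in Hvw
      ... | true  = cong (_∧ true) (adjacent⇒complete v w Hvw)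
      ... | false = ∧-zeroʳ (complete v w)

    halfL≡degrees : halfL H c (c u) ω ≡ ⌊ degTo complete c u ω ≤? 2 * degTo H c u ω ⌋
    halfL≡degrees = ⌊⌋-⇔ _ _
      (λ le → *-cancelˡ-≤ s (subst₂ _≤_ possiblePairs≡ (rearrange presentPairs≡) le))
      (λ le → subst₂ _≤_ (sym possiblePairs≡) (sym (rearrange presentPairs≡)) (*-monoʳ-≤ s le))
      where
      s = count (c has c u)
      instance
        s-nonZero : NonZero s
        s-nonZero = >-nonZero (count-positive u (≡⇒has c u refl))
      rearrange : ∀ {p d} → p ≡ s * d → 2 * p ≡ s * (2 * d)
      rearrange {d = d} p≡sd = trans (cong (2 *_) p≡sd) (x∙yz≈y∙xz 2 s d)

    D-sparse : 2 * degTo (D H c) c u ω ≤ count (c has ω)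
    D-sparse = by-density (eK ≤? 2 * eH) halfL≡degrees
      where
      open ≤-Reasoning
      eD = degTo (D H c) c u ω
      eH = degTo H c u ω
      eK = degTo complete c u ω

      eK≤∣ω∣ : eK ≤ count (c has ω)
      eK≤∣ω∣ = ≤-trans (m≤m+n eK _) (≤-reflexive (degTo-complete c u ω))

      by-density : (dense? : Dec (eK ≤ 2 * eH)) → halfL H c (c u) ω ≡ ⌊ dense? ⌋ →
        2 * eD ≤ count (c has ω)
      by-density (yes eK≤2eH) dense = begin
        2 * eD   ≡⟨ cong (eD +_) (+-identityʳ eD) ⟩
        eD + eD  ≤⟨ +-monoʳ-≤ eD eD≤eH ⟩
        eD + eH  ≡⟨ eD+eH≡eK ⟩
        eK       ≤⟨ eK≤∣ω∣ ⟩
        count (c has ω) ∎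
        where
        eD+eH≡eK : eD + eH ≡ eK
        eD+eH≡eK = degTo-DL-true (halfL H c) u ω dense
        eD≤eH : eD ≤ eH
        eD≤eH = +-cancelʳ-≤ eH eD eH (begin
          eD + eH  ≡⟨ eD+eH≡eK ⟩
          eK       ≤⟨ eK≤2eH ⟩
          2 * eH   ≡⟨ cong (eH +_) (+-identityʳ eH) ⟩
          eH + eH  ∎)
      by-density (no eK≰2eH) sparse = begin
        2 * eD  ≡⟨ cong (2 *_) (degTo-DL-false (halfL H c) u ω sparse) ⟩
        2 * eH  ≤⟨ <⇒≤ (≰⇒> eK≰2eH) ⟩
        eK      ≤⟨ eK≤∣ω∣ ⟩
        count (c has ω) ∎

module _ {n k k₀} {H : Adj n} (isGraph : IsGraph H)
         {c : Fin n → Fin k} (equitable : Equitable H c)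
         {c₀ : Fin n → Fin k₀} (coarsening : Coarsening c₀ c) (L₀ : Fin k₀ → Fin k₀ → Bool)
         {v : Fin n} {X₁ : Fin n → Bool} (X₁-component : IsComponent (DL H c₀ L₀) v X₁) where

  private
    G₁ G : Adj n
    G₁ = DL H c₀ L₀
    G  = D H c

  HalfCovered : Fin k → Set
  HalfCovered ω = count (c has ω) ≤ 2 * count (X₁ ∩ (c has ω))

  halfCovered? : ∀ ω → Dec (HalfCovered ω)
  halfCovered? ω = count (c has ω) ≤? 2 * count (X₁ ∩ (c has ω))

  G₁-between : ∀ {u w b y} → c b ≡ c u → c y ≡ c w →
    G₁ b y ≡ (complete b y ∧ L₀ (c₀ u) (c₀ w)) xor H b y
  G₁-between {b = b} {y} cb≡cu cy≡cw =
    cong (λ l → (complete b y ∧ l) xor H b y)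
         (cong₂ L₀ (coarsening _ _ cb≡cu) (coarsening _ _ cy≡cw))

  G-between : ∀ {u w b y} → c b ≡ c u → c y ≡ c w →
    G b y ≡ (complete b y ∧ halfL H c (c u) (c w)) xor H b y
  G-between {b = b} {y} cb≡cu cy≡cw =
    cong (λ l → (complete b y ∧ l) xor H b y) (cong₂ (halfL H c) cb≡cu cy≡cw)

  agreeing⇒G⊆G₁ : ∀ {u w b y} → L₀ (c₀ u) (c₀ w) ≡ halfL H c (c u) (c w) →
    c b ≡ c u → c y ≡ c w → G b y ≡ true → G₁ b y ≡ true
  agreeing⇒G⊆G₁ {b = b} {y} agree cb≡cu cy≡cw Gby =
    trans (G₁-between cb≡cu cy≡cw)
          (trans (cong (λ l → (complete b y ∧ l) xor H b y) agree)
                 (trans (sym (G-between cb≡cu cy≡cw)) Gby))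

  flipped⇒G₁≡notG : ∀ {u w b y} → L₀ (c₀ u) (c₀ w) ≡ not (halfL H c (c u) (c w)) →
    c b ≡ c u → c y ≡ c w → complete b y ≡ true → G₁ b y ≡ not (G b y)
  flipped⇒G₁≡notG {u} {w} {b} {y} flipped cb≡cu cy≡cw b≢y = begin
    G₁ b y                                       ≡⟨ G₁-between cb≡cu cy≡cw ⟩
    (complete b y ∧ L₀ (c₀ u) (c₀ w)) xor H b y  ≡⟨ cong₂ (λ a l → (a ∧ l) xor H b y) b≢y flipped ⟩
    not ℓ xor H b y                              ≡⟨ not-distribˡ-xor ℓ (H b y) ⟨
    not (ℓ xor H b y)                            ≡⟨ cong (λ a → not ((a ∧ ℓ) xor H b y)) b≢y ⟨
    not ((complete b y ∧ ℓ) xor H b y)           ≡⟨ cong not (G-between cb≡cu cy≡cw) ⟨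
    not (G b y)                                  ∎
    where
    open ≡-Reasoning
    ℓ = halfL H c (c u) (c w)

  flipped⇒halfCovered : ∀ {u w} → X₁ u ≡ true → L₀ (c₀ u) (c₀ w) ≡ not (halfL H c (c u) (c w)) →
    HalfCovered (c w)
  flipped⇒halfCovered {u} {w} u∈X₁ flipped = begin
    ∣ C ∣              ≡⟨ split ⟨
    eD + r             ≤⟨ +-monoˡ-≤ r eD≤r ⟩
    r + r              ≡⟨ cong (r +_) (+-identityʳ r) ⟨
    2 * r              ≤⟨ *-monoʳ-≤ 2 (count-mono non-neighbour∈X₁) ⟩
    2 * ∣ X₁ ∩ C ∣     ∎
    where
    open ≤-Reasoning
    ∣_∣ = count
    C = c has c w
    eD = degTo G c u (c w)
    r = count (λ y → not (G u y) ∧ C y)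
    split : eD + r ≡ ∣ C ∣
    split = count-+ λ y → partition (G u y) (C y)
      where
      partition : ∀ g s → 𝟙 (g ∧ s) + 𝟙 (not g ∧ s) ≡ 𝟙 s
      partition true  s = +-identityʳ (𝟙 s)
      partition false s = refl
    eD≤r : eD ≤ r
    eD≤r = +-cancelˡ-≤ eD eD r (begin
      eD + eD  ≡⟨ cong (eD +_) (+-identityʳ eD) ⟨
      2 * eD   ≤⟨ D-sparse isGraph c equitable u (c w) ⟩
      ∣ C ∣    ≡⟨ split ⟨
      eD + r   ∎)
    non-neighbour∈X₁ : ∀ y → not (G u y) ∧ C y ≡ true → (X₁ ∩ C) y ≡ true
    non-neighbour∈X₁ y y∉N∧y∈C with ∧-elim {not (G u y)} y∉N∧y∈C | u ≟ y
    ... | _ , y∈C | yes refl = cong₂ _∧_ u∈X₁ y∈C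
    ... | ¬Guy , y∈C | no u≢y = cong₂ _∧_
      (component-closed X₁-component u∈X₁
        (trans (flipped⇒G₁≡notG flipped refl (has⇒≡ c y y∈C) (distinct⇒complete u≢y)) ¬Guy))
      y∈C

  X₁⁺ : Fin n → Bool
  X₁⁺ w = X₁ w ∨ ⌊ halfCovered? (c w) ⌋

  X₁⊆X₁⁺ : ∀ {w} → X₁ w ≡ true → X₁⁺ w ≡ true
  X₁⊆X₁⁺ {w} w∈X₁ = cong (_∨ ⌊ halfCovered? (c w) ⌋) w∈X₁

  halfCovered⇒∈X₁⁺ : ∀ {w} → HalfCovered (c w) → X₁⁺ w ≡ true
  halfCovered⇒∈X₁⁺ {w} half =
    trans (cong (X₁ w ∨_) (⌊⌋-true (halfCovered? (c w)) half)) (∨-zeroʳ (X₁ w))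

  ∈X₁⁺-outside-halfCovered : ∀ {w ω} → ¬ HalfCovered ω → c w ≡ ω → X₁⁺ w ≡ X₁ w
  ∈X₁⁺-outside-halfCovered {w} {ω} ¬half cw≡ω =
    trans (cong (λ x → X₁ w ∨ ⌊ halfCovered? x ⌋) cw≡ω)
          (trans (cong (X₁ w ∨_) (⌊⌋-false (halfCovered? ω) ¬half)) (∨-identityʳ (X₁ w)))

  ∈X₁⁺-elim : ∀ w → X₁⁺ w ≡ true → X₁ w ≡ true ⊎ HalfCovered (c w)
  ∈X₁⁺-elim w w∈X₁⁺ with X₁ w | halfCovered? (c w)
  ∈X₁⁺-elim w _  | true  | _        = inj₁ refl
  ∈X₁⁺-elim w _  | false | yes half = inj₂ half
  ∈X₁⁺-elim w () | false | no _

  halfCovered⇒meets-X₁ : ∀ u → HalfCovered (c u) → ∃ λ u′ → X₁ u′ ≡ true × c u′ ≡ c u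
  halfCovered⇒meets-X₁ u half =
    let (u′ , u′∈X₁∩C) = count-witness (X₁ ∩ (c has c u)) (halve (≤-trans u∈C half))
        (u′∈X₁ , u′∈C) = ∧-elim {X₁ u′} u′∈X₁∩C
    in u′ , u′∈X₁ , has⇒≡ c u′ u′∈C
    where
    u∈C : 1 ≤ count (c has c u)
    u∈C = count-positive u (≡⇒has c u refl)
    halve : ∀ {x} → 1 ≤ 2 * x → 1 ≤ x
    halve {suc x} _ = s≤s z≤n

  halfCovered-propagates : ∀ {u′ u w} → X₁ u′ ≡ true → c u′ ≡ c u →
    HalfCovered (c u) → G u w ≡ true → HalfCovered (c w)
  halfCovered-propagates {u′} {u} {w} u′∈X₁ cu′≡cu half Guw
    with ≡-or-≡not (L₀ (c₀ u′) (c₀ w)) (halfL H c (c u′) (c w))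
  ... | inj₂ flipped = flipped⇒halfCovered u′∈X₁ flipped
  ... | inj₁ agree   = density-transfer (DL-equitable isGraph c equitable (halfL H c))
                                        (DL-transpose-equitable isGraph c equitable (halfL H c))
                                        X₁ 2 Guw X₁-closed half
    where
    X₁-closed : ∀ b y → c b ≡ c u → c y ≡ c w → X₁ b ≡ true → G b y ≡ true → X₁ y ≡ true
    X₁-closed b y cb≡cu cy≡cw b∈X₁ Gby = component-closed X₁-component b∈X₁
      (agreeing⇒G⊆G₁ agree (trans cb≡cu (sym cu′≡cu)) cy≡cw Gby)

  X₁⁺-closed : ∀ {u w} → X₁⁺ u ≡ true → G u w ≡ true → X₁⁺ w ≡ true
  X₁⁺-closed {u} {w} u∈X₁⁺ Guw with ∈X₁⁺-elim u u∈X₁⁺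
  ... | inj₂ half =
    let (u′ , u′∈X₁ , cu′≡cu) = halfCovered⇒meets-X₁ u half
    in halfCovered⇒∈X₁⁺ (halfCovered-propagates u′∈X₁ cu′≡cu half Guw)
  ... | inj₁ u∈X₁ with ≡-or-≡not (L₀ (c₀ u) (c₀ w)) (halfL H c (c u) (c w))
  ...   | inj₁ agree   =
    X₁⊆X₁⁺ (component-closed X₁-component u∈X₁ (agreeing⇒G⊆G₁ agree refl refl Guw))
  ...   | inj₂ flipped = halfCovered⇒∈X₁⁺ (flipped⇒halfCovered u∈X₁ flipped)

  X₁⁺-bound : count X₁⁺ ≤ 2 * count X₁
  X₁⁺-bound = count-≤-by-class c 2 classwise
    where
    classwise : ∀ ω → count (X₁⁺ ∩ (c has ω)) ≤ 2 * count (X₁ ∩ (c has ω))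
    classwise ω with halfCovered? ω
    ... | yes half = ≤-trans (count-mono λ w → proj₂ ∘ ∧-elim {X₁⁺ w}) half
    ... | no ¬half = ≤-trans
      (≤-reflexive (count-cong λ w → ∧-cong-when ((c has ω) w) λ w∈ω →
        ∈X₁⁺-outside-halfCovered ¬half (has⇒≡ c w w∈ω)))
      (m≤m+n _ _)

  component-bound : ∀ {X₂} → IsComponent (D H c) v X₂ → count X₂ ≤ 2 * count X₁
  component-bound {X₂} X₂-component = ≤-trans (count-mono X₂⊆X₁⁺) X₁⁺-bound
    where
    X₂⊆X₁⁺ : ∀ w → X₂ w ≡ true → X₁⁺ w ≡ true
    X₂⊆X₁⁺ = component-minimal X₂-component X₁⁺ (X₁⊆X₁⁺ (component-root X₁-component)) X₁⁺-closed

lemma6p3 : ∀ {n k} (H : Adj n) (c : Fin n → Fin k) →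
    IsGraph H → Equitable H c →
    ((L : Fin k → Fin k → Bool) → (∀ ω ω' → L ω ω' ≡ L ω' ω) →
      ∀ v (X₁ X₂ : Fin n → Bool) →
      IsComponent (DL H c L) v X₁ → IsComponent (D H c) v X₂ →
      count X₂ ≤ 2 * count X₁)
    ×
    (∀ {k₀} (c₀ : Fin n → Fin k₀) → Coarsening c₀ c →
      ∀ v (X₁ X₂ : Fin n → Bool) →
      IsComponent (D H c₀) v X₁ → IsComponent (D H c) v X₂ →
      count X₂ ≤ 2 * count X₁)
lemma6p3 H c isGraph equitable =
  (λ L _ v X₁ X₂ X₁-component →
     component-bound isGraph equitable (λ _ _ cv≡cw → cv≡cw) L X₁-component) ,
  (λ c₀ coarsening v X₁ X₂ X₁-component →
     component-bound isGraph equitable coarsening (halfL H c₀) X₁-component)
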